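{- Let $k \geq 1$ and let $\mathcal{T}$ be a tree containing a split $A|B$ with $|B| \leq k$. Then every convex character of $\mathcal{T}$ in which every state has at least $k$ taxa has a state that is a superset of $B$. If moreover $|B| < k$, then every such character has a state that is a strict superset of $B$.
   Context: A tree (unrooted binary phylogenetic $X$-tree) is a finite unrooted tree in which every internal vertex has degree 3 and whose leaves are bijectively labelled by a finite set $X$ of taxa. A bipartition $A|B$ of $X$ is a split of $\mathcal{T}$ if deleting a single edge of $\mathcal{T}$ leaves two components whose taxa sets are $A$ and $B$. A character on $X$ is a partition of $X$ into non-empty blocks (states); it is convex on $\mathcal{T}$ if the minimal subtrees of $\mathcal{T}$ spanning distinct states are vertex-disjoint. -}

module Defs where

open import Data.Nat using (ℕ; _≤_)
open import Data.Fin using (Fin)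
open import Data.Fin.Subset using (Subset)
open import Data.Bool using (true; false)
open import Data.List using (List; head; last; length)
open import Data.List.Relation.Unary.Linked using (Linked)
open import Data.List.Relation.Unary.Unique.Propositional using (Unique)
open import Data.List.Membership.Propositional using () renaming (_∈_ to _∈ₗ_)
open import Data.Maybe using (just)
open import Data.Product using (Σ; ∃; ∃-syntax; _×_)
open import Data.Sum using (_⊎_)
open import Relation.Nullary using (¬_; does)
open import Relation.Binary.PropositionalEquality using (_≡_; _≢_)
open import Function using (Injective; Surjective)
open import Data.Vec using (tabulate)
import Data.Fin as F

IsPath : ∀ {m} → (Fin m → Fin m → Set) → Fin m → Fin m → List (Fin m) → Set
IsPath Adj a b p = Linked Adj p × Unique p × head p ≡ just a × last p ≡ just b

IsCycle : ∀ {m} → (Fin m → Fin m → Set) → List (Fin m) → Set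
IsCycle Adj c = 3 ≤ length c × Linked Adj c × Unique c ×
  (∃[ a ] ∃[ b ] (head c ≡ just a × last c ≡ just b × Adj b a))

AtMostOneNbr : ∀ {m} → (Fin m → Fin m → Set) → Fin m → Set
AtMostOneNbr Adj v = ∀ u w → Adj v u → Adj v w → u ≡ w

Degree3 : ∀ {m} → (Fin m → Fin m → Set) → Fin m → Set
Degree3 Adj v = ∃[ a ] ∃[ b ] ∃[ c ]
  (a ≢ b × a ≢ c × b ≢ c × Adj v a × Adj v b × Adj v c ×
   (∀ u → Adj v u → u ≡ a ⊎ u ≡ b ⊎ u ≡ c))

-- Unrooted binary phylogenetic X-tree with X = Fin n.
record PhyloTree (n : ℕ) : Set₁ where
  field
    m         : ℕ
    Adj       : Fin m → Fin m → Set
    adj-sym   : ∀ {u v} → Adj u v → Adj v u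
    adj-irr   : ∀ {u} → ¬ Adj u u
    connected : ∀ a b → ∃[ p ] IsPath Adj a b p
    acyclic   : ∀ c → ¬ IsCycle Adj c
    label     : Fin n → Fin m
    label-inj : Injective _≡_ _≡_ label
    leaf⇒labelled : ∀ v → AtMostOneNbr Adj v → ∃[ x ] label x ≡ v
    labelled⇒leaf : ∀ x → AtMostOneNbr Adj (label x)
    internal  : ∀ v → ¬ (∃[ x ] label x ≡ v) → Degree3 Adj v

module _ {n : ℕ} (T : PhyloTree n) where
  open PhyloTree T

  AdjWithout : Fin m → Fin m → Fin m → Fin m → Set
  AdjWithout u v a b = Adj a b × ¬ (a ≡ u × b ≡ v) × ¬ (a ≡ v × b ≡ u)

  -- B is one side of a split A|B: for some edge {u,v}, B is the set of taxa
  -- in the component containing v after deleting the edge {u,v}.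
  IsSplitSide : Subset n → Set
  IsSplitSide B = ∃[ u ] ∃[ v ] (Adj u v ×
    (∀ x → (x Data.Fin.Subset.∈ B → ∃[ p ] IsPath (AdjWithout u v) v (label x) p)
         × (∃[ p ] IsPath (AdjWithout u v) v (label x) p → x Data.Fin.Subset.∈ B)))

  -- vertex w lies in the minimal subtree spanning the taxa of state s of χ
  InSpan : ∀ {r} → (Fin n → Fin r) → Fin r → Fin m → Set
  InSpan χ s w = ∃[ x ] ∃[ y ] (χ x ≡ s × χ y ≡ s ×
    ∃[ p ] (IsPath Adj (label x) (label y) p × w ∈ₗ p))

  Convex : ∀ {r} → (Fin n → Fin r) → Set
  Convex χ = ∀ s t w → s ≢ t → InSpan χ s w → InSpan χ t w → Data.Empty.⊥
    where import Data.Empty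

-- A character on X = Fin n with r states: a surjection χ : Fin n → Fin r;
-- its states (blocks) are the fibres.
IsCharacter : ∀ {n r} → (Fin n → Fin r) → Set
IsCharacter χ = ∀ s → ∃[ x ] χ x ≡ s

block : ∀ {n r} → (Fin n → Fin r) → Fin r → Subset n
block χ s = tabulate (λ x → does (χ x F.≟ s))

-- Let u–v be the split edge with B on the side of v. A path between a taxon of B and a taxon
-- outside B must pass through u. A state meeting B has at least k ≥ |B| taxa, so if it misses
-- some taxon of B it cannot lie inside B; it then has taxa on both sides and its spanning subtree
-- contains u. Two distinct states meeting B would both contain u, contradicting convexity, so B
-- lies inside a single state s, strictly when |B| < k ≤ |s|. (For B = ∅ one still needs some
-- taxon: in a tree without leaves every vertex has degree 3, giving arbitrarily long paths.)
module Submission where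

open import Defs
open import Data.Nat using (ℕ; _≤_; _<_)
open import Data.Fin using (Fin)
open import Data.Fin.Subset using (Subset; ∣_∣; _⊆_; _⊂_)
open import Data.Product using (∃-syntax; _×_)

open import Data.Nat using (zero; suc; z≤n; s≤s; _≤?_)
open import Data.Nat.Properties using (≤-trans; <-≤-trans; ≰⇒>; <⇒≱; n≤1+n)
import Data.Fin as Fin
open import Data.Fin.Properties using (_≟_; ¬∀⟶∃¬; any?; pigeonhole)
open import Data.Fin.Subset using (_∈_; _∉_; _⊈_)
open import Data.Fin.Subset.Properties using (_∈?_; p⊆q⇒∣p∣≤∣q∣; p⊂q⇒∣p∣<∣q∣)
open import Data.List using (List; []; _∷_; head; last; length; _∷ʳ_; lookup)
open import Data.List.Relation.Unary.Linked using (Linked; []; [-]; _∷_)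
import Data.List.Relation.Unary.Linked.Properties as Linked
open import Data.List.Relation.Unary.AllPairs using ([]; _∷_)
open import Data.List.Relation.Unary.Unique.Propositional using (Unique)
import Data.List.Relation.Unary.Unique.Propositional.Properties as Unique
open import Data.List.Relation.Unary.All using (All; []; _∷_)
open import Data.List.Relation.Unary.All.Properties using (¬Any⇒All¬)
open import Data.List.Relation.Unary.Any using (here; there)
open import Data.List.Membership.Propositional using () renaming (_∈_ to _∈ₗ_)
import Data.List.Membership.DecPropositional as DecMembership
open import Data.Maybe using (just)
open import Data.Maybe.Relation.Binary.Connected using (Connected; just)
open import Data.Product using (∃; ∃₂; _,_; proj₁; proj₂)
open import Data.Sum using (_⊎_; inj₁; inj₂)
open import Data.Empty using (⊥-elim)
open import Data.Vec.Properties using (lookup⇒[]=; []=⇒lookup; lookup∘tabulate)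
open import Relation.Nullary using (¬_; yes; no; contradiction)
open import Relation.Nullary.Decidable using (_×-dec_; _→-dec_; dec-true; dec-false; decidable-stable)
open import Relation.Binary.PropositionalEquality using (_≡_; _≢_; refl; sym; trans; cong; subst)

module _ {m : ℕ} where

  prefixTo : ∀ {x} (xs : List (Fin m)) → x ∈ₗ xs → List (Fin m)
  prefixTo (y ∷ ys) (here _)    = y ∷ []
  prefixTo (y ∷ ys) (there x∈ys) = y ∷ prefixTo ys x∈ys

  head-prefixTo : ∀ {x} xs (x∈xs : x ∈ₗ xs) → head (prefixTo xs x∈xs) ≡ head xs
  head-prefixTo (y ∷ ys) (here _)  = refl
  head-prefixTo (y ∷ ys) (there _) = refl

  last-prefixTo : ∀ {x} xs (x∈xs : x ∈ₗ xs) → last (prefixTo xs x∈xs) ≡ just x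
  last-prefixTo (y ∷ ys)     (here refl)            = refl
  last-prefixTo (y ∷ z ∷ zs) (there (here refl))    = refl
  last-prefixTo (y ∷ z ∷ zs) (there (there x∈zs)) = last-prefixTo (z ∷ zs) (there x∈zs)

  1≤length-prefixTo : ∀ {x} xs (x∈xs : x ∈ₗ xs) → 1 ≤ length (prefixTo xs x∈xs)
  1≤length-prefixTo (y ∷ ys) (here _)  = s≤s z≤n
  1≤length-prefixTo (y ∷ ys) (there _) = s≤s z≤n

  linked-prefixTo : ∀ {R : Fin m → Fin m → Set} {x} xs (x∈xs : x ∈ₗ xs) →
                    Linked R xs → Linked R (prefixTo xs x∈xs)
  linked-prefixTo (y ∷ ys)     (here _)              _        = [-]
  linked-prefixTo (y ∷ z ∷ zs) (there (here _))      (r ∷ _)  = r ∷ [-]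
  linked-prefixTo (y ∷ z ∷ zs) (there (there x∈zs)) (r ∷ rs) =
    r ∷ linked-prefixTo (z ∷ zs) (there x∈zs) rs

  all-prefixTo : ∀ {P : Fin m → Set} {x} xs (x∈xs : x ∈ₗ xs) →
                 All P xs → All P (prefixTo xs x∈xs)
  all-prefixTo (y ∷ ys) (here _)     (py ∷ _)   = py ∷ []
  all-prefixTo (y ∷ ys) (there x∈ys) (py ∷ pys) = py ∷ all-prefixTo ys x∈ys pys

  unique-prefixTo : ∀ {x} xs (x∈xs : x ∈ₗ xs) → Unique xs → Unique (prefixTo xs x∈xs)
  unique-prefixTo (y ∷ ys) (here _)     _          = [] ∷ []
  unique-prefixTo (y ∷ ys) (there x∈ys) (y∉ ∷ uys) =
    all-prefixTo ys x∈ys y∉ ∷ unique-prefixTo ys x∈ys uys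

  head-∷ʳ : ∀ {a c} (xs : List (Fin m)) → head xs ≡ just a → head (xs ∷ʳ c) ≡ just a
  head-∷ʳ (y ∷ ys) eq = eq

  last-∷ʳ : ∀ {c} (xs : List (Fin m)) → last (xs ∷ʳ c) ≡ just c
  last-∷ʳ []           = refl
  last-∷ʳ (y ∷ [])     = refl
  last-∷ʳ (y ∷ z ∷ zs) = last-∷ʳ (z ∷ zs)

  private
    All-lookup : ∀ {P : Fin m → Set} (xs : List (Fin m)) → All P xs →
                 (i : Fin (length xs)) → P (lookup xs i)
    All-lookup (y ∷ ys) (py ∷ _)   Fin.zero    = py
    All-lookup (y ∷ ys) (_ ∷ pys) (Fin.suc i) = All-lookup ys pys i

    Unique-lookup : ∀ (xs : List (Fin m)) → Unique xs →
                    ∀ i j → i Fin.< j → lookup xs i ≢ lookup xs j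
    Unique-lookup (y ∷ ys) (y∉ ∷ _)   Fin.zero    (Fin.suc j) _         = All-lookup ys y∉ j
    Unique-lookup (y ∷ ys) (_ ∷ uys) (Fin.suc i) (Fin.suc j) (s≤s i<j) = Unique-lookup ys uys i j i<j

  Unique⇒length≤ : ∀ (xs : List (Fin m)) → Unique xs → length xs ≤ m
  Unique⇒length≤ xs unique with length xs ≤? m
  ... | yes ≤m = ≤m
  ... | no  ≰m with pigeonhole (≰⇒> ≰m) (lookup xs)
  ...   | i , j , i<j , eq = ⊥-elim (Unique-lookup xs unique i j i<j eq)

module _ {m : ℕ} {R : Fin m → Fin m → Set} where

  Path : Fin m → Fin m → Set
  Path a b = ∃[ p ] IsPath R a b p

  Path-extend : ∀ {a b c} → Path a b → R b c → Path a c
  Path-extend {c = c} (p , linked , unique , head≡a , last≡b) r with DecMembership._∈?_ _≟_ c p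
  ... | yes c∈p = prefixTo p c∈p , linked-prefixTo p c∈p linked , unique-prefixTo p c∈p unique ,
                  trans (head-prefixTo p c∈p) head≡a , last-prefixTo p c∈p
  ... | no c∉p = p ∷ʳ c ,
                 Linked.++⁺ linked (subst (λ l → Connected R l (just c)) (sym last≡b) (just r)) [-] ,
                 Unique.++⁺ unique ([] ∷ []) (λ { (c∈p , here refl) → c∉p c∈p }) ,
                 head-∷ʳ p head≡a , last-∷ʳ p

  Path-extendAlong : ∀ {a w z} (p : List (Fin m)) → Linked R p →
                     head p ≡ just w → last p ≡ just z → Path a w → Path a z
  Path-extendAlong (y ∷ [])     [-]      refl refl path = path
  Path-extendAlong (y ∷ y′ ∷ p) (r ∷ rs) refl last≡z path =
    Path-extendAlong (y′ ∷ p) rs refl last≡z (Path-extend path r)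

module _ {m : ℕ} {Adj : Fin m → Fin m → Set}
         (adj-sym : ∀ {u v} → Adj u v → Adj v u) (adj-irr : ∀ {u} → ¬ Adj u u)
         (acyclic : ∀ c → ¬ IsCycle Adj c)
         (branching : ∀ a → ∃₂ λ c d → c ≢ d × Adj a c × Adj a d) where

  -- The first two vertices are exposed: the next vertex is chosen away from the second.
  LongPath : ℕ → Set
  LongPath L = ∃[ a ] ∃[ b ] ∃[ rest ]
    (Linked Adj (a ∷ b ∷ rest) × Unique (a ∷ b ∷ rest) × length rest ≡ L)

  private
    otherNeighbour : ∀ a b → ∃[ c ] (Adj a c × c ≢ b)
    otherNeighbour a b with branching a
    ... | c , d , c≢d , a~c , a~d with c ≟ b
    ...   | no  c≢b = c , a~c , c≢b
    ...   | yes c≡b = d , a~d , λ d≡b → c≢d (trans c≡b (sym d≡b))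

  -- The other neighbour c of the first vertex is new: c ≡ a is a loop, c ≡ b is the
  -- edge just used, and c further along the path closes a cycle.
  LongPath-extend : ∀ {L} → LongPath L → LongPath (suc L)
  LongPath-extend (a , b , rest , linked , unique , length≡L) with otherNeighbour a b
  ... | c , a~c , c≢b with DecMembership._∈?_ _≟_ c (a ∷ b ∷ rest)
  ... | no c∉ = c , a , b ∷ rest , adj-sym a~c ∷ linked , ¬Any⇒All¬ (a ∷ b ∷ rest) c∉ ∷ unique ,
                cong suc length≡L
  ... | yes (here c≡a)         = ⊥-elim (adj-irr (subst (Adj a) c≡a a~c))
  ... | yes (there (here c≡b)) = ⊥-elim (c≢b c≡b)
  ... | yes (there (there c∈rest)) = ⊥-elim (acyclic cycle
        ( s≤s (s≤s (1≤length-prefixTo rest c∈rest))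
        , linked-prefixTo (a ∷ b ∷ rest) c∈ linked
        , unique-prefixTo (a ∷ b ∷ rest) c∈ unique
        , a , c , refl , last-prefixTo (a ∷ b ∷ rest) c∈ , adj-sym a~c ))
    where
      c∈ : c ∈ₗ a ∷ b ∷ rest
      c∈ = there (there c∈rest)
      cycle : List (Fin m)
      cycle = prefixTo (a ∷ b ∷ rest) c∈

  longPath : ∀ {u v} → Adj u v → ∀ L → LongPath L
  longPath {u} {v} u~v zero = v , u , [] , adj-sym u~v ∷ [-] ,
    ((λ v≡u → adj-irr (subst (Adj u) v≡u u~v)) ∷ []) ∷ [] ∷ [] , refl
  longPath u~v (suc L) = LongPath-extend (longPath u~v L)

  -- A path has at most m vertices, so no path has m + 2.
  branching-acyclic⇒edgeless : ∀ {u v} → ¬ Adj u v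
  branching-acyclic⇒edgeless u~v with longPath u~v m
  ... | a , b , rest , _ , unique , length≡m =
    <⇒≱ (s≤s (n≤1+n _))
        (subst (λ l → suc (suc l) ≤ m) length≡m (Unique⇒length≤ (a ∷ b ∷ rest) unique))

module _ {n : ℕ} (T : PhyloTree n) where
  open PhyloTree T

  linked⇒∈⊎linkedWithout : ∀ u v (p : List (Fin m)) → Linked Adj p →
                           u ∈ₗ p ⊎ Linked (AdjWithout T u v) p
  linked⇒∈⊎linkedWithout u v []           []       = inj₂ []
  linked⇒∈⊎linkedWithout u v (a ∷ [])     [-]      = inj₂ [-]
  linked⇒∈⊎linkedWithout u v (a ∷ b ∷ p) (r ∷ rs) with linked⇒∈⊎linkedWithout u v (b ∷ p) rs
  ... | inj₁ u∈ = inj₁ (there u∈)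
  ... | inj₂ rs′ with (a ≟ u) ×-dec (b ≟ v) | (a ≟ v) ×-dec (b ≟ u)
  ...   | yes (a≡u , _) | _             = inj₁ (here (sym a≡u))
  ...   | no _          | yes (_ , b≡u) = inj₁ (there (here (sym b≡u)))
  ...   | no ¬uv        | no ¬vu        = inj₂ ((r , ¬uv , ¬vu) ∷ rs′)

  SideOf : Fin m → Fin m → Subset n → Set
  SideOf u v B = ∀ x → (x ∈ B → Path {R = AdjWithout T u v} v (label x))
                      × (Path {R = AdjWithout T u v} v (label x) → x ∈ B)

  SideOf-crossing : ∀ {u v B x y p} → SideOf u v B → x ∈ B → y ∉ B →
                    IsPath Adj (label x) (label y) p → u ∈ₗ p
  SideOf-crossing {u} {v} {p = p} side x∈B y∉B (linked , _ , head≡x , last≡y)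
    with linked⇒∈⊎linkedWithout u v p linked
  ... | inj₁ u∈p    = u∈p
  ... | inj₂ linked′ =
    ⊥-elim (y∉B (proj₂ (side _) (Path-extendAlong p linked′ head≡x last≡y (proj₁ (side _) x∈B))))

  straddling⇒inSpan : ∀ {u v B r} (χ : Fin n → Fin r) {t x y} → SideOf u v B →
                      x ∈ B → y ∉ B → χ x ≡ t → χ y ≡ t → InSpan T χ t u
  straddling⇒inSpan χ {x = x} {y} side x∈B y∉B χx≡t χy≡t with connected (label x) (label y)
  ... | p , path = x , y , χx≡t , χy≡t , p , path , SideOf-crossing side x∈B y∉B path

edge⇒taxon : ∀ {n} (T : PhyloTree n) {u v} → PhyloTree.Adj T u v → Fin n
edge⇒taxon {suc n} T _   = Fin.zero
edge⇒taxon {zero}  T u~v = ⊥-elim (branching-acyclic⇒edgeless adj-sym adj-irr acyclic branching u~v)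
  where
    open PhyloTree T
    branching : ∀ a → ∃₂ λ c d → c ≢ d × Adj a c × Adj a d
    branching a with internal a (λ { (() , _) })
    ... | c , d , _ , c≢d , _ , _ , a~c , a~d , _ = c , d , c≢d , a~c , a~d

module _ {n : ℕ} where

  ⊈⇒∃∉ : ∀ {p q : Subset n} → p ⊈ q → ∃ λ x → x ∈ p × x ∉ q
  ⊈⇒∃∉ {p} {q} p⊈q
    with ¬∀⟶∃¬ n (λ x → x ∈ p → x ∈ q) (λ x → (x ∈? p) →-dec (x ∈? q)) (λ p⊆q → p⊈q (p⊆q _))
  ... | x , ¬[x∈p⇒x∈q] = x , decidable-stable (x ∈? p) (λ x∉p → ¬[x∈p⇒x∈q] (λ x∈p → ⊥-elim (x∉p x∈p)))
                      , λ x∈q → ¬[x∈p⇒x∈q] (λ _ → x∈q)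

  ∣p∣≤∣q∣∧p⊈q⇒q⊈p : ∀ {p q : Subset n} → ∣ p ∣ ≤ ∣ q ∣ → p ⊈ q → q ⊈ p
  ∣p∣≤∣q∣∧p⊈q⇒q⊈p ∣p∣≤∣q∣ p⊈q q⊆p = <⇒≱ (p⊂q⇒∣p∣<∣q∣ (q⊆p , ⊈⇒∃∉ p⊈q)) ∣p∣≤∣q∣

  p⊆q∧∣p∣<∣q∣⇒p⊂q : ∀ {p q : Subset n} → p ⊆ q → ∣ p ∣ < ∣ q ∣ → p ⊂ q
  p⊆q∧∣p∣<∣q∣⇒p⊂q p⊆q ∣p∣<∣q∣ = p⊆q , ⊈⇒∃∉ (λ q⊆p → <⇒≱ ∣p∣<∣q∣ (p⊆q⇒∣p∣≤∣q∣ q⊆p))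

module _ {n r : ℕ} (χ : Fin n → Fin r) where

  ∈-block⁺ : ∀ {x s} → χ x ≡ s → x ∈ block χ s
  ∈-block⁺ {x} {s} χx≡s =
    lookup⇒[]= x _ (trans (lookup∘tabulate _ x) (dec-true (χ x Fin.≟ s) χx≡s))

  ∈-block⁻ : ∀ {x s} → x ∈ block χ s → χ x ≡ s
  ∈-block⁻ {x} {s} x∈ = decidable-stable (χ x Fin.≟ s) λ χx≢s →
    contradiction (trans (sym ([]=⇒lookup x∈)) (trans (lookup∘tabulate _ x) (dec-false (χ x Fin.≟ s) χx≢s)))
                  λ ()

  monochromatic⇒⊆block : Fin n → ∀ {B} → (∀ {a b} → a ∈ B → b ∈ B → χ a ≡ χ b) →
                         ∃[ s ] B ⊆ block χ s
  monochromatic⇒⊆block x₀ {B} mono with any? (_∈? B)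
  ... | yes (a , a∈B) = χ a , λ b∈B → ∈-block⁺ (sym (mono a∈B b∈B))
  ... | no  B-empty   = χ x₀ , λ {b} b∈B → ⊥-elim (B-empty (b , b∈B))

module _ {n r} (k : ℕ) (T : PhyloTree n) {u v} {B : Subset n}
         (side : SideOf T u v B) (∣B∣≤k : ∣ B ∣ ≤ k)
         (χ : Fin n → Fin r) (convex : Convex T χ) (large : ∀ s → k ≤ ∣ block χ s ∣) where

  -- A state meeting B but missing part of it is too large to fit inside B.
  u∈span : ∀ {a} → a ∈ B → B ⊈ block χ (χ a) → InSpan T χ (χ a) u
  u∈span a∈B B⊈ with ⊈⇒∃∉ (∣p∣≤∣q∣∧p⊈q⇒q⊈p (≤-trans ∣B∣≤k (large _)) B⊈)
  ... | z , z∈ , z∉B = straddling⇒inSpan T χ side a∈B z∉B refl (∈-block⁻ χ z∈)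

  B-monochromatic : ∀ {a b} → a ∈ B → b ∈ B → χ a ≡ χ b
  B-monochromatic {a} {b} a∈B b∈B with χ a Fin.≟ χ b
  ... | yes χa≡χb = χa≡χb
  ... | no  χa≢χb = ⊥-elim (convex (χ a) (χ b) u χa≢χb
    (u∈span a∈B (λ B⊆ → χa≢χb (sym (∈-block⁻ χ (B⊆ b∈B)))))
    (u∈span b∈B (λ B⊆ → χa≢χb (∈-block⁻ χ (B⊆ a∈B)))))

mainTheorem16 : ∀ {n} (k : ℕ) → 1 ≤ k → (T : PhyloTree n) → (B : Subset n) →
    IsSplitSide T B → ∣ B ∣ ≤ k →
    ∀ r (χ : Fin n → Fin r) → IsCharacter χ → Convex T χ →
    (∀ s → k ≤ ∣ block χ s ∣) →
    (∃[ s ] B ⊆ block χ s) × (∣ B ∣ < k → ∃[ s ] B ⊂ block χ s)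
mainTheorem16 k _ T B (u , v , u~v , side) ∣B∣≤k r χ _ convex large
  with s , B⊆s ← monochromatic⇒⊆block χ (edge⇒taxon T u~v)
                   (B-monochromatic k T side ∣B∣≤k χ convex large)
  = (s , B⊆s) , λ ∣B∣<k → s , p⊆q∧∣p∣<∣q∣⇒p⊂q B⊆s (<-≤-trans ∣B∣<k (large s))
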